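{- Let $\chi=(p\wedge\sim p)\to(q\vee\sim q)$ and $\mathsf{NK}^\bot=\mathsf{N4}^\bot+\{\chi\}$. Then $\mathsf{NK}^\bot$ has no modal companion. More generally, for every superintuitionistic logic $L$ with $L\subseteq\mathsf{HT}=\mathsf{Int}+\{p\vee(p\to q)\vee\neg q\}$, the logic $\mathsf{NK}^\bot+L$ has no modal companion; consequently there are continuum many extensions of $\mathsf{N4}^\bot$ that have no modal companion.
   Context: Languages: $\mathcal{L}_i=\{\wedge,\vee,\to,\bot\}$, $\mathcal{L}_\sim=\mathcal{L}_i\cup\{\sim\}$, $\mathcal{L}^\Box_\sim=\mathcal{L}_\sim\cup\{\Box,\Diamond\}$, formulas over a countable set of variables; $\neg\varphi:=\varphi\to\bot$, $\varphi\leftrightarrow\psi:=(\varphi\to\psi)\wedge(\psi\to\varphi)$, $\varphi\Leftrightarrow\psi:=(\varphi\leftrightarrow\psi)\wedge(\sim\varphi\leftrightarrow\sim\psi)$. A logic in $\mathcal{L}_i$ or $\mathcal{L}_\sim$ is a set of formulas closed under substitution and modus ponens; a logic in $\mathcal{L}^\Box_\sim$ is additionally closed under $\varphi\to\psi/\Box\varphi\to\Box\psi$ and $\varphi\to\psi/\Diamond\varphi\to\Diamond\psi$. $\mathsf{Int}$ is the least logic in $\mathcal{L}_i$ containing $p\to(q\to p)$; $(p\to(q\to r))\to((p\to q)\to(p\to r))$; $p\wedge q\to p$; $p\wedge q\to q$; $p\to(q\to p\wedge q)$; $p\to p\vee q$; $q\to p\vee q$; $(p\to r)\to((q\to r)\to(p\vee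 q\to r))$; $\bot\to p$; a superintuitionistic logic is a logic in $\mathcal{L}_i$ containing $\mathsf{Int}$. $\mathsf{N4}^\bot$ is the least logic in $\mathcal{L}_\sim$ containing the axioms of $\mathsf{Int}$ and $\sim(p\vee q)\leftrightarrow(\sim p\wedge\sim q)$, $\sim(p\wedge q)\leftrightarrow(\sim p\vee\sim q)$, $\sim(p\to q)\leftrightarrow(p\wedge\sim q)$, $\sim\sim p\leftrightarrow p$, $\sim\bot$. $\mathsf{BS4}$ is the least logic in $\mathcal{L}^\Box_\sim$ containing these axioms, $p\vee\neg p$, $\Box(p\to p)$, $(\Box p\wedge\Box q)\to\Box(p\wedge q)$, $\Box p\to p$, $\Box p\to\Box\Box p$, $\neg\Box p\leftrightarrow\Diamond\neg p$, $\neg\Diamond p\leftrightarrow\Box\neg p$, $\Box p\Leftrightarrow\sim\Diamond\sim p$, $\Diamond p\Leftrightarrow\sim\Box\sim p$. Extensions are logics (in the same language) containing the given one; $L+X$ is the least logic containing $L\cup X$ (so $\mathsf{NK}^\bot+L$ is the least logic in $\mathcal{L}_\sim$ containing $\mathsf{NK}^\bot\cup L$). Translation $\mathrm{T}_{\mathbf{B}}$: $\mathrm{T}_{\mathbf{B}}(p)=\Box p$, $\mathrm{T}_{\mathbf{B}}(\sim p)=\Box\sim p$, $\mathrm{T}_{\mathbf{B}}(\bot)=\bot$, $\mathrm{T}_{\mathbf{B}}(\sim\bot)=\sim\bot$, $\mathrm{T}_{\mathbf{B}}(\varphi\wedge\psi)=\mathrm{T}_{\mathbf{B}}\varphi\wedge\mathrm{T}_{\mathbf{B}}\psi$,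 $\mathrm{T}_{\mathbf{B}}(\varphi\vee\psi)=\mathrm{T}_{\mathbf{B}}\varphi\vee\mathrm{T}_{\mathbf{B}}\psi$, $\mathrm{T}_{\mathbf{B}}(\varphi\to\psi)=\Box(\mathrm{T}_{\mathbf{B}}\varphi\to\mathrm{T}_{\mathbf{B}}\psi)$, $\mathrm{T}_{\mathbf{B}}(\sim(\varphi\wedge\psi))=\mathrm{T}_{\mathbf{B}}(\sim\varphi)\vee\mathrm{T}_{\mathbf{B}}(\sim\psi)$, $\mathrm{T}_{\mathbf{B}}(\sim(\varphi\vee\psi))=\mathrm{T}_{\mathbf{B}}(\sim\varphi)\wedge\mathrm{T}_{\mathbf{B}}(\sim\psi)$, $\mathrm{T}_{\mathbf{B}}(\sim(\varphi\to\psi))=\mathrm{T}_{\mathbf{B}}\varphi\wedge\mathrm{T}_{\mathbf{B}}(\sim\psi)$, $\mathrm{T}_{\mathbf{B}}(\sim\sim\varphi)=\mathrm{T}_{\mathbf{B}}\varphi$. A modal companion of an extension $L'$ of $\mathsf{N4}^\bot$ is an extension $M$ of $\mathsf{BS4}$ such that for every $\mathcal{L}_\sim$-formula $\varphi$: $\varphi\in L'\iff\mathrm{T}_{\mathbf{B}}\varphi\in M$. -}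

module Defs where

open import Data.Nat using (ℕ)
open import Data.Bool using (Bool)
open import Data.Product using (_×_; Σ; ∃; _,_)
open import Data.Empty using (⊥)
open import Data.Sum using (_⊎_)
open import Relation.Nullary using (¬_)
open import Relation.Binary.PropositionalEquality using (_≡_)

infixr 6 _∧_
infixr 5 _∨_
infixr 4 _⇒_
infix 7 ∼_ □_ ◇_

data FormI : Set where
  var  : ℕ → FormI
  _∧_  : FormI → FormI → FormI
  _∨_  : FormI → FormI → FormI
  _⇒_  : FormI → FormI → FormI
  fls  : FormI

data FormN : Set where
  var  : ℕ → FormN
  _∧_  : FormN → FormN → FormN
  _∨_  : FormN → FormN → FormN
  _⇒_  : FormN → FormN → FormN
  fls  : FormN
  ∼_   : FormN → FormN

data FormM : Set where
  var  : ℕ → FormM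
  _∧_  : FormM → FormM → FormM
  _∨_  : FormM → FormM → FormM
  _⇒_  : FormM → FormM → FormM
  fls  : FormM
  ∼_   : FormM → FormM
  □_   : FormM → FormM
  ◇_   : FormM → FormM

embI : FormI → FormN
embI (var n) = var n
embI (a ∧ b) = embI a ∧ embI b
embI (a ∨ b) = embI a ∨ embI b
embI (a ⇒ b) = embI a ⇒ embI b
embI fls     = fls

embN : FormN → FormM
embN (var n) = var n
embN (a ∧ b) = embN a ∧ embN b
embN (a ∨ b) = embN a ∨ embN b
embN (a ⇒ b) = embN a ⇒ embN b
embN fls     = fls
embN (∼ a)   = ∼ embN a

subI : (ℕ → FormI) → FormI → FormI
subI σ (var n) = σ n
subI σ (a ∧ b) = subI σ a ∧ subI σ b
subI σ (a ∨ b) = subI σ a ∨ subI σ b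
subI σ (a ⇒ b) = subI σ a ⇒ subI σ b
subI σ fls     = fls

subN : (ℕ → FormN) → FormN → FormN
subN σ (var n) = σ n
subN σ (a ∧ b) = subN σ a ∧ subN σ b
subN σ (a ∨ b) = subN σ a ∨ subN σ b
subN σ (a ⇒ b) = subN σ a ⇒ subN σ b
subN σ fls     = fls
subN σ (∼ a)   = ∼ subN σ a

subM : (ℕ → FormM) → FormM → FormM
subM σ (var n) = σ n
subM σ (a ∧ b) = subM σ a ∧ subM σ b
subM σ (a ∨ b) = subM σ a ∨ subM σ b
subM σ (a ⇒ b) = subM σ a ⇒ subM σ b
subM σ fls     = fls
subM σ (∼ a)   = ∼ subM σ a
subM σ (□ a)   = □ subM σ a
subM σ (◇ a)   = ◇ subM σ a

¬I_ : FormI → FormI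
¬I a = a ⇒ fls

¬N_ : FormN → FormN
¬N a = a ⇒ fls

_↔N_ : FormN → FormN → FormN
a ↔N b = (a ⇒ b) ∧ (b ⇒ a)

¬M_ : FormM → FormM
¬M a = a ⇒ fls

_↔M_ : FormM → FormM → FormM
a ↔M b = (a ⇒ b) ∧ (b ⇒ a)

_⇔M_ : FormM → FormM → FormM
a ⇔M b = (a ↔M b) ∧ ((∼ a) ↔M (∼ b))

Pred : Set → Set₁
Pred A = A → Set

_⊆_ : {A : Set} → Pred A → Pred A → Set
X ⊆ Y = ∀ φ → X φ → Y φ

record IsLogicI (L : Pred FormI) : Set where
  field
    closed-sub : ∀ σ φ → L φ → L (subI σ φ)
    closed-mp  : ∀ φ ψ → L φ → L (φ ⇒ ψ) → L ψ

record IsLogicN (L : Pred FormN) : Set where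
  field
    closed-sub : ∀ σ φ → L φ → L (subN σ φ)
    closed-mp  : ∀ φ ψ → L φ → L (φ ⇒ ψ) → L ψ

record IsLogicM (L : Pred FormM) : Set where
  field
    closed-sub : ∀ σ φ → L φ → L (subM σ φ)
    closed-mp  : ∀ φ ψ → L φ → L (φ ⇒ ψ) → L ψ
    closed-□   : ∀ φ ψ → L (φ ⇒ ψ) → L ((□ φ) ⇒ (□ ψ))
    closed-◇   : ∀ φ ψ → L (φ ⇒ ψ) → L ((◇ φ) ⇒ (◇ ψ))

data GenI (X : Pred FormI) : Pred FormI where
  ax : ∀ σ φ → X φ → GenI X (subI σ φ)
  mp : ∀ φ ψ → GenI X φ → GenI X (φ ⇒ ψ) → GenI X ψ

data GenN (X : Pred FormN) : Pred FormN where
  ax : ∀ σ φ → X φ → GenN X (subN σ φ)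
  mp : ∀ φ ψ → GenN X φ → GenN X (φ ⇒ ψ) → GenN X ψ

data GenM (X : Pred FormM) : Pred FormM where
  ax  : ∀ σ φ → X φ → GenM X (subM σ φ)
  mp  : ∀ φ ψ → GenM X φ → GenM X (φ ⇒ ψ) → GenM X ψ
  mon□ : ∀ φ ψ → GenM X (φ ⇒ ψ) → GenM X ((□ φ) ⇒ (□ ψ))
  mon◇ : ∀ φ ψ → GenM X (φ ⇒ ψ) → GenM X ((◇ φ) ⇒ (◇ ψ))

_∪_ : {A : Set} → Pred A → Pred A → Pred A
(X ∪ Y) φ = X φ ⊎ Y φ

⟦_⟧ : {A : Set} → A → Pred A
⟦ a ⟧ φ = a ≡ φ

module AxI where
  p q r : FormI
  p = var 0
  q = var 1
  r = var 2

  data IntAx : Pred FormI where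
    k     : IntAx (p ⇒ (q ⇒ p))
    s     : IntAx ((p ⇒ (q ⇒ r)) ⇒ ((p ⇒ q) ⇒ (p ⇒ r)))
    ∧e1   : IntAx ((p ∧ q) ⇒ p)
    ∧e2   : IntAx ((p ∧ q) ⇒ q)
    ∧i    : IntAx (p ⇒ (q ⇒ (p ∧ q)))
    ∨i1   : IntAx (p ⇒ (p ∨ q))
    ∨i2   : IntAx (q ⇒ (p ∨ q))
    ∨e    : IntAx ((p ⇒ r) ⇒ ((q ⇒ r) ⇒ ((p ∨ q) ⇒ r)))
    efq   : IntAx (fls ⇒ p)

  htAx : FormI
  htAx = p ∨ ((p ⇒ q) ∨ (¬I q))

module AxN where
  open AxI using (IntAx)
  p q : FormN
  p = var 0
  q = var 1

  data N4Ax : Pred FormN where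
    int   : ∀ {φ} → IntAx φ → N4Ax (embI φ)
    ∼∨    : N4Ax ((∼ (p ∨ q)) ↔N ((∼ p) ∧ (∼ q)))
    ∼∧    : N4Ax ((∼ (p ∧ q)) ↔N ((∼ p) ∨ (∼ q)))
    ∼⇒    : N4Ax ((∼ (p ⇒ q)) ↔N (p ∧ (∼ q)))
    ∼∼    : N4Ax ((∼ (∼ p)) ↔N p)
    ∼fls  : N4Ax (∼ fls)

  χ : FormN
  χ = (p ∧ (∼ p)) ⇒ (q ∨ (∼ q))

module AxM where
  open AxN using (N4Ax)
  p q : FormM
  p = var 0
  q = var 1

  data BS4Ax : Pred FormM where
    n4    : ∀ {φ} → N4Ax φ → BS4Ax (embN φ)
    lem   : BS4Ax (p ∨ (¬M p))
    nec   : BS4Ax (□ (p ⇒ p))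
    K∧    : BS4Ax (((□ p) ∧ (□ q)) ⇒ (□ (p ∧ q)))
    T     : BS4Ax ((□ p) ⇒ p)
    four  : BS4Ax ((□ p) ⇒ (□ (□ p)))
    ¬□    : BS4Ax ((¬M (□ p)) ↔M (◇ (¬M p)))
    ¬◇    : BS4Ax ((¬M (◇ p)) ↔M (□ (¬M p)))
    □dual : BS4Ax ((□ p) ⇔M (∼ (◇ (∼ p))))
    ◇dual : BS4Ax ((◇ p) ⇔M (∼ (□ (∼ p))))

open AxI using (IntAx; htAx) public
open AxN using (N4Ax; χ) public
open AxM using (BS4Ax) public

Int : Pred FormI
Int = GenI IntAx

HT : Pred FormI
HT = GenI (IntAx ∪ ⟦ htAx ⟧)

N4⊥ : Pred FormN
N4⊥ = GenN N4Ax

NK⊥ : Pred FormN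
NK⊥ = GenN (N4Ax ∪ ⟦ χ ⟧)

NK⊥+_ : Pred FormI → Pred FormN
(NK⊥+ L) = GenN ((N4Ax ∪ ⟦ χ ⟧) ∪ (λ φ → Σ FormI (λ ψ → L ψ × (embI ψ ≡ φ))))

BS4 : Pred FormM
BS4 = GenM BS4Ax

SuperIntuitionistic : Pred FormI → Set
SuperIntuitionistic L = IsLogicI L × (Int ⊆ L)

ExtensionOfN4⊥ : Pred FormN → Set
ExtensionOfN4⊥ L = IsLogicN L × (N4⊥ ⊆ L)

ExtensionOfBS4 : Pred FormM → Set
ExtensionOfBS4 M = IsLogicM M × (BS4 ⊆ M)

-- The translation T_B  (TB φ = T_B φ, TB∼ φ = T_B (∼ φ))

mutual
  TB : FormN → FormM
  TB (var n) = □ (var n)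
  TB fls     = fls
  TB (a ∧ b) = TB a ∧ TB b
  TB (a ∨ b) = TB a ∨ TB b
  TB (a ⇒ b) = □ (TB a ⇒ TB b)
  TB (∼ a)   = TB∼ a

  TB∼ : FormN → FormM
  TB∼ (var n) = □ (∼ (var n))
  TB∼ fls     = ∼ fls
  TB∼ (a ∧ b) = TB∼ a ∨ TB∼ b
  TB∼ (a ∨ b) = TB∼ a ∧ TB∼ b
  TB∼ (a ⇒ b) = TB a ∧ TB∼ b
  TB∼ (∼ a)   = TB a

ModalCompanion : Pred FormN → Pred FormM → Set
ModalCompanion L' M =
  ExtensionOfBS4 M × (∀ φ → (L' φ → M (TB φ)) × (M (TB φ) → L' φ))

HasNoModalCompanion : Pred FormN → Set₁
HasNoModalCompanion L' = ∀ (M : Pred FormM) → ¬ ModalCompanion L' M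

-- In BS4 the instance p := ◇p of T_B χ derives T_B ψ for ψ = (∼p ∧ ¬¬p) → (q ∨ ∼q): □∼p gives
-- □∼◇p by ◇/□-duality and 4, and □¬□¬□p gives □◇p by T and ¬◇ ↔ □¬.  So no logic containing χ but
-- not ψ has a modal companion.  χ is valid in every Kripke model of N4 whose gluts occur only at
-- maximal points deciding every variable, and ψ fails in such a model on the two-element chain
-- (p glutted at the top).  That chain validates HT, and the Jankov formula of each frame F (4 + n)
-- (a root, 4 + n maximal points, a point below each triple of them), since no generated subframe of
-- the chain maps p-morphically onto F (4 + n).  Nor does one of F (4 + m) for m ≢ n, while F (4 + n)
-- refutes its own Jankov formula; so the logics NK⊥ + {jankov n | f n} are pairwise distinct.

module Submission where

open import Defs
open import Data.Nat using (ℕ; _+_; _≟_)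
import Data.Nat as ℕ
open import Data.Nat.Properties using (+-cancelˡ-≡; ≤-antisym)
open import Data.Bool using (Bool; true; false)
open import Data.Product using (_×_; Σ; _,_; proj₁; proj₂)
open import Data.Sum using (_⊎_; inj₁; inj₂)
open import Data.Empty using (⊥; ⊥-elim)
import Data.Empty.Irrelevant as Irrelevant
open import Data.Unit using (⊤; tt)
open import Data.Fin using (Fin; zero; suc; toℕ; _↑ˡ_) renaming (_≟_ to _≟ᶠ_)
open import Data.Fin.Properties using (toℕ-injective; ↑ˡ-injective; injective⇒≤)
open import Data.List using (List; []; _∷_; _++_; map; concatMap; allFin; filter; lookup)
open import Data.List.Membership.Propositional using (_∈_; lose)
open import Data.List.Membership.Propositional.Properties
  using (∈-map⁺; ∈-allFin; ∈-++⁺ˡ; ∈-++⁺ʳ; ∈-concatMap⁺; ∈-filter⁺; ∈-filter⁻)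
open import Data.List.Relation.Unary.Any using (here; there; index; any?; satisfied)
open import Data.List.Relation.Unary.Any.Properties using (lookup-index)
open import Relation.Nullary using (¬_; Dec; yes; no; ¬?)
open import Relation.Nullary.Decidable using (_×-dec_; _⊎-dec_; _→-dec_; decidable-stable)
open import Relation.Binary.PropositionalEquality using (_≡_; _≢_; refl; sym; trans; cong; cong₂; subst)
open AxI.IntAx renaming (k to K; s to S)
open AxN.N4Ax
open AxM.BS4Ax

ψ : FormN
ψ = (∼ AxN.p ∧ ¬N (¬N AxN.p)) ⇒ (AxN.q ∨ ∼ AxN.q)

subN-∘ : ∀ σ τ φ → subN σ (subN τ φ) ≡ subN (λ i → subN σ (τ i)) φ
subN-∘ σ τ (var n) = refl
subN-∘ σ τ (a ∧ b) = cong₂ _∧_ (subN-∘ σ τ a) (subN-∘ σ τ b)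
subN-∘ σ τ (a ∨ b) = cong₂ _∨_ (subN-∘ σ τ a) (subN-∘ σ τ b)
subN-∘ σ τ (a ⇒ b) = cong₂ _⇒_ (subN-∘ σ τ a) (subN-∘ σ τ b)
subN-∘ σ τ fls     = refl
subN-∘ σ τ (∼ a)   = cong ∼_ (subN-∘ σ τ a)

subN-var : ∀ φ → subN var φ ≡ φ
subN-var (var n) = refl
subN-var (a ∧ b) = cong₂ _∧_ (subN-var a) (subN-var b)
subN-var (a ∨ b) = cong₂ _∨_ (subN-var a) (subN-var b)
subN-var (a ⇒ b) = cong₂ _⇒_ (subN-var a) (subN-var b)
subN-var fls     = refl
subN-var (∼ a)   = cong ∼_ (subN-var a)

embI-subI : ∀ σ φ → embI (subI σ φ) ≡ subN (λ i → embI (σ i)) (embI φ)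
embI-subI σ (var n) = refl
embI-subI σ (a ∧ b) = cong₂ _∧_ (embI-subI σ a) (embI-subI σ b)
embI-subI σ (a ∨ b) = cong₂ _∨_ (embI-subI σ a) (embI-subI σ b)
embI-subI σ (a ⇒ b) = cong₂ _⇒_ (embI-subI σ a) (embI-subI σ b)
embI-subI σ fls     = refl

GenN-sub : ∀ {X} σ φ → GenN X φ → GenN X (subN σ φ)
GenN-sub σ _ (ax τ φ x)   = subst (GenN _) (sym (subN-∘ σ τ φ)) (ax (λ i → subN σ (τ i)) φ x)
GenN-sub σ _ (mp φ ψ d e) = mp (subN σ φ) (subN σ ψ) (GenN-sub σ φ d) (GenN-sub σ _ e)

GenN-mono : ∀ {X Y} → X ⊆ Y → GenN X ⊆ GenN Y
GenN-mono X⊆Y _ (ax σ φ x)   = ax σ φ (X⊆Y φ x)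
GenN-mono X⊆Y _ (mp φ ψ d e) = mp φ ψ (GenN-mono X⊆Y φ d) (GenN-mono X⊆Y _ e)

GenN-ax : ∀ {X} φ → X φ → GenN X φ
GenN-ax φ x = subst (GenN _) (subN-var φ) (ax var φ x)

GenN-isLogic : ∀ X → IsLogicN (GenN X)
GenN-isLogic X = record { closed-sub = GenN-sub ; closed-mp = mp }

module BS4-Reasoning where

  inst : FormM → FormM → FormM → ℕ → FormM
  inst A B C 0 = A
  inst A B C 1 = B
  inst A B C _ = C

  mp⁺ : ∀ {A B} → BS4 A → BS4 (A ⇒ B) → BS4 B
  mp⁺ {A} {B} = mp A B

  axK : ∀ A B → BS4 (A ⇒ (B ⇒ A))
  axK A B = ax (inst A B fls) _ (n4 (int K))

  axS : ∀ A B C → BS4 ((A ⇒ (B ⇒ C)) ⇒ ((A ⇒ B) ⇒ (A ⇒ C)))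
  axS A B C = ax (inst A B C) _ (n4 (int S))

  ⇒-refl : ∀ A → BS4 (A ⇒ A)
  ⇒-refl A = mp⁺ (axK A A) (mp⁺ (axK A (A ⇒ A)) (axS A (A ⇒ A) A))

  ⇒-trans : ∀ {A B C} → BS4 (A ⇒ B) → BS4 (B ⇒ C) → BS4 (A ⇒ C)
  ⇒-trans {A} {B} {C} d e = mp⁺ d (mp⁺ (mp⁺ e (axK (B ⇒ C) A)) (axS A B C))

  ⇒-swap : ∀ {A B C} → BS4 (A ⇒ (B ⇒ C)) → BS4 (B ⇒ (A ⇒ C))
  ⇒-swap {A} {B} {C} d =
    mp⁺ (axK B A) (mp⁺ (⇒-trans (mp⁺ d (axK (A ⇒ (B ⇒ C)) B)) (axS A B C)) (axS B (A ⇒ B) (A ⇒ C)))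

  ⇒-compose : ∀ A B C → BS4 ((B ⇒ C) ⇒ ((A ⇒ B) ⇒ (A ⇒ C)))
  ⇒-compose A B C = ⇒-trans (axK (B ⇒ C) A) (axS A B C)

  ⇒-antecedent : ∀ {A B} C → BS4 (A ⇒ B) → BS4 ((B ⇒ C) ⇒ (A ⇒ C))
  ⇒-antecedent {A} {B} C d = mp⁺ d (⇒-swap (⇒-compose A B C))

  ⇒-consequent : ∀ {B C} A → BS4 (B ⇒ C) → BS4 ((A ⇒ B) ⇒ (A ⇒ C))
  ⇒-consequent {B} {C} A d = mp⁺ d (⇒-compose A B C)

  ∧-elimˡ : ∀ A B → BS4 ((A ∧ B) ⇒ A)
  ∧-elimˡ A B = ax (inst A B fls) _ (n4 (int ∧e1))

  ∧-elimʳ : ∀ A B → BS4 ((A ∧ B) ⇒ B)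
  ∧-elimʳ A B = ax (inst A B fls) _ (n4 (int ∧e2))

  ∧-intro : ∀ {X A B} → BS4 (X ⇒ A) → BS4 (X ⇒ B) → BS4 (X ⇒ (A ∧ B))
  ∧-intro {X} {A} {B} d e =
    mp⁺ e (mp⁺ (⇒-trans d (ax (inst A B fls) _ (n4 (int ∧i)))) (axS X B (A ∧ B)))

  proj₁⁺ : ∀ {A B} → BS4 (A ∧ B) → BS4 A
  proj₁⁺ {A} {B} d = mp⁺ d (∧-elimˡ A B)

  proj₂⁺ : ∀ {A B} → BS4 (A ∧ B) → BS4 B
  proj₂⁺ {A} {B} d = mp⁺ d (∧-elimʳ A B)

  ex-falso : ∀ A → BS4 (fls ⇒ A)
  ex-falso A = ax (inst A fls fls) _ (n4 (int efq))

  ¬¬-elim : ∀ A → BS4 (¬M (¬M A) ⇒ A)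
  ¬¬-elim A = mp⁺ (ax (inst A fls fls) _ lem) (mp⁺ ¬A⇒ (mp⁺ (axK A (¬M (¬M A))) ∨-elim))
    where
    ¬A⇒ : BS4 (¬M A ⇒ (¬M (¬M A) ⇒ A))
    ¬A⇒ = ⇒-trans (⇒-swap (⇒-refl (¬M (¬M A)))) (⇒-consequent (¬M (¬M A)) (ex-falso A))
    ∨-elim : BS4 ((A ⇒ (¬M (¬M A) ⇒ A)) ⇒ ((¬M A ⇒ (¬M (¬M A) ⇒ A)) ⇒ ((A ∨ ¬M A) ⇒ (¬M (¬M A) ⇒ A))))
    ∨-elim = ax (inst A (¬M A) (¬M (¬M A) ⇒ A)) _ (n4 (int ∨e))


open BS4-Reasoning
open AxM using (p)

□∼⇒□∼◇ : BS4 (□ (∼ p) ⇒ □ (∼ (◇ p)))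
□∼⇒□∼◇ = ⇒-trans (ax (inst (∼ p) fls fls) _ four) (mon□ _ _ (⇒-trans ∼∼-intro ∼∼□∼⇒∼◇))
  where
  ∼∼-intro : BS4 (□ (∼ p) ⇒ ∼ (∼ (□ (∼ p))))
  ∼∼-intro = proj₂⁺ (ax (inst (□ (∼ p)) fls fls) _ (n4 ∼∼))
  ∼∼□∼⇒∼◇ : BS4 (∼ (∼ (□ (∼ p))) ⇒ ∼ (◇ p))
  ∼∼□∼⇒∼◇ = proj₂⁺ (proj₂⁺ (ax (inst p fls fls) _ ◇dual))

□¬□¬□⇒□◇ : BS4 (□ (¬M (□ (¬M (□ p)))) ⇒ □ (◇ p))
□¬□¬□⇒□◇ = mon□ _ _ (⇒-trans (⇒-antecedent fls □¬⇒□¬□) (⇒-trans (⇒-antecedent fls ¬◇⇒□¬) (¬¬-elim (◇ p))))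
  where
  □¬⇒□¬□ : BS4 (□ (¬M p) ⇒ □ (¬M (□ p)))
  □¬⇒□¬□ = mon□ _ _ (⇒-antecedent fls (ax (inst p fls fls) _ T))
  ¬◇⇒□¬ : BS4 (¬M (◇ p) ⇒ □ (¬M p))
  ¬◇⇒□¬ = proj₁⁺ (ax (inst p fls fls) _ ¬◇)

TBψ-antecedent⇒TBχ-antecedent[◇p] : BS4 (TB (∼ AxN.p ∧ ¬N (¬N AxN.p)) ⇒ (□ (◇ p) ∧ □ (∼ (◇ p))))
TBψ-antecedent⇒TBχ-antecedent[◇p] =
  ∧-intro (⇒-trans (∧-elimʳ _ _) □¬□¬□⇒□◇) (⇒-trans (∧-elimˡ _ _) □∼⇒□∼◇)

p≔◇p : ℕ → FormM
p≔◇p 0 = ◇ p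
p≔◇p n = var n

noModalCompanion : (L' : Pred FormN) → L' χ → ¬ L' ψ → HasNoModalCompanion L'
noModalCompanion L' χ∈L' ψ∉L' M ((logic , BS4⊆M) , faithful) = ψ∉L' (proj₂ (faithful ψ) TBψ∈M)
  where
  open IsLogicM logic
  TBχ[◇p]∈M : M (subM p≔◇p (TB χ))
  TBχ[◇p]∈M = closed-sub p≔◇p (TB χ) (proj₁ (faithful χ) χ∈L')
  TBψ∈M : M (TB ψ)
  TBψ∈M = closed-mp _ _ TBχ[◇p]∈M
    (closed-□ _ _ (BS4⊆M _ (⇒-antecedent (TB (AxN.q ∨ ∼ AxN.q)) TBψ-antecedent⇒TBχ-antecedent[◇p])))

record FiniteFrame : Set₁ where
  field
    W       : Set
    _≼_     : W → W → Set
    _≼?_    : ∀ x y → Dec (x ≼ y)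
    ≼-refl  : ∀ {x} → x ≼ x
    ≼-trans : ∀ {x y z} → x ≼ y → y ≼ z → x ≼ z
    points  : List W
    ∈-points : ∀ x → x ∈ points

  Maximal : W → Set
  Maximal x = ∀ {y} → x ≼ y → y ≡ x

  ∃? : {Q : W → Set} → (∀ x → Dec (Q x)) → Dec (Σ W Q)
  ∃? Q? with any? Q? points
  ... | yes q = yes (satisfied q)
  ... | no ∄ = no λ (x , qx) → ∄ (lose (∈-points x) qx)

  ∀? : {Q : W → Set} → (∀ x → Dec (Q x)) → Dec (∀ x → Q x)
  ∀? Q? with ∃? (λ x → ¬? (Q? x))
  ... | yes (x , ¬qx) = no λ q → ¬qx (q x)
  ... | no ∄ = yes λ x → decidable-stable (Q? x) λ ¬qx → ∄ (x , ¬qx)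

record Valuation (F : FiniteFrame) : Set₁ where
  open FiniteFrame F
  field
    V⁺ V⁻   : ℕ → W → Set
    V⁺?     : ∀ i x → Dec (V⁺ i x)
    V⁻?     : ∀ i x → Dec (V⁻ i x)
    V⁺-mono : ∀ {i x y} → x ≼ y → V⁺ i x → V⁺ i y
    V⁻-mono : ∀ {i x y} → x ≼ y → V⁻ i x → V⁻ i y

module Semantics {F : FiniteFrame} (v : Valuation F) where
  open FiniteFrame F
  open Valuation v

  infix 3.5 _⊩⁺_ _⊩⁻_ _⊩⁺?_ _⊩⁻?_

  mutual
    _⊩⁺_ : W → FormN → Set
    x ⊩⁺ var i = V⁺ i x
    x ⊩⁺ a ∧ b = x ⊩⁺ a × x ⊩⁺ b
    x ⊩⁺ a ∨ b = x ⊩⁺ a ⊎ x ⊩⁺ b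
    x ⊩⁺ a ⇒ b = ∀ y → x ≼ y → y ⊩⁺ a → y ⊩⁺ b
    x ⊩⁺ fls   = ⊥
    x ⊩⁺ ∼ a   = x ⊩⁻ a

    _⊩⁻_ : W → FormN → Set
    x ⊩⁻ var i = V⁻ i x
    x ⊩⁻ a ∧ b = x ⊩⁻ a ⊎ x ⊩⁻ b
    x ⊩⁻ a ∨ b = x ⊩⁻ a × x ⊩⁻ b
    x ⊩⁻ a ⇒ b = x ⊩⁺ a × x ⊩⁻ b
    x ⊩⁻ fls   = ⊤
    x ⊩⁻ ∼ a   = x ⊩⁺ a

  mutual
    ⊩⁺-mono : ∀ φ {x y} → x ≼ y → x ⊩⁺ φ → y ⊩⁺ φ
    ⊩⁺-mono (var i) x≼y h          = V⁺-mono x≼y h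
    ⊩⁺-mono (a ∧ b) x≼y (ha , hb)  = ⊩⁺-mono a x≼y ha , ⊩⁺-mono b x≼y hb
    ⊩⁺-mono (a ∨ b) x≼y (inj₁ h)   = inj₁ (⊩⁺-mono a x≼y h)
    ⊩⁺-mono (a ∨ b) x≼y (inj₂ h)   = inj₂ (⊩⁺-mono b x≼y h)
    ⊩⁺-mono (a ⇒ b) x≼y h          = λ z y≼z → h z (≼-trans x≼y y≼z)
    ⊩⁺-mono (∼ a)   x≼y h          = ⊩⁻-mono a x≼y h

    ⊩⁻-mono : ∀ φ {x y} → x ≼ y → x ⊩⁻ φ → y ⊩⁻ φ
    ⊩⁻-mono (var i) x≼y h          = V⁻-mono x≼y h
    ⊩⁻-mono (a ∧ b) x≼y (inj₁ h)   = inj₁ (⊩⁻-mono a x≼y h)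
    ⊩⁻-mono (a ∧ b) x≼y (inj₂ h)   = inj₂ (⊩⁻-mono b x≼y h)
    ⊩⁻-mono (a ∨ b) x≼y (ha , hb)  = ⊩⁻-mono a x≼y ha , ⊩⁻-mono b x≼y hb
    ⊩⁻-mono (a ⇒ b) x≼y (ha , hb)  = ⊩⁺-mono a x≼y ha , ⊩⁻-mono b x≼y hb
    ⊩⁻-mono fls     x≼y h          = tt
    ⊩⁻-mono (∼ a)   x≼y h          = ⊩⁺-mono a x≼y h

  mutual
    _⊩⁺?_ : ∀ x φ → Dec (x ⊩⁺ φ)
    x ⊩⁺? var i = V⁺? i x
    x ⊩⁺? a ∧ b = (x ⊩⁺? a) ×-dec (x ⊩⁺? b)
    x ⊩⁺? a ∨ b = (x ⊩⁺? a) ⊎-dec (x ⊩⁺? b)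
    x ⊩⁺? a ⇒ b = ∀? λ y → (x ≼? y) →-dec ((y ⊩⁺? a) →-dec (y ⊩⁺? b))
    x ⊩⁺? fls   = no λ ()
    x ⊩⁺? ∼ a   = x ⊩⁻? a

    _⊩⁻?_ : ∀ x φ → Dec (x ⊩⁻ φ)
    x ⊩⁻? var i = V⁻? i x
    x ⊩⁻? a ∧ b = (x ⊩⁻? a) ⊎-dec (x ⊩⁻? b)
    x ⊩⁻? a ∨ b = (x ⊩⁻? a) ×-dec (x ⊩⁻? b)
    x ⊩⁻? a ⇒ b = (x ⊩⁺? a) ×-dec (x ⊩⁻? b)
    x ⊩⁻? fls   = yes tt
    x ⊩⁻? ∼ a   = x ⊩⁺? a

  induced : (ℕ → FormN) → Valuation F
  induced σ = record
    { V⁺ = λ i x → x ⊩⁺ σ i ; V⁻ = λ i x → x ⊩⁻ σ i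
    ; V⁺? = λ i x → x ⊩⁺? σ i ; V⁻? = λ i x → x ⊩⁻? σ i
    ; V⁺-mono = λ {i} → ⊩⁺-mono (σ i) ; V⁻-mono = λ {i} → ⊩⁻-mono (σ i) }

  VarGlut : W → Set
  VarGlut x = Σ ℕ λ i → V⁺ i x × V⁻ i x

  VarComplete : W → Set
  VarComplete x = ∀ i → V⁺ i x ⊎ V⁻ i x

  glut⇒var-glut : ∀ φ {x} → x ⊩⁺ φ → x ⊩⁻ φ → VarGlut x
  glut⇒var-glut (var i) h⁺ h⁻                    = i , h⁺ , h⁻
  glut⇒var-glut (a ∧ b) (ha , hb) (inj₁ h⁻)      = glut⇒var-glut a ha h⁻
  glut⇒var-glut (a ∧ b) (ha , hb) (inj₂ h⁻)      = glut⇒var-glut b hb h⁻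
  glut⇒var-glut (a ∨ b) (inj₁ h⁺) (ha , hb)      = glut⇒var-glut a h⁺ ha
  glut⇒var-glut (a ∨ b) (inj₂ h⁺) (ha , hb)      = glut⇒var-glut b h⁺ hb
  glut⇒var-glut (a ⇒ b) {x} h⁺ (ha , hb)         = glut⇒var-glut b (h⁺ x ≼-refl ha) hb
  glut⇒var-glut (∼ a) h⁺ h⁻                      = glut⇒var-glut a h⁻ h⁺

  complete-at-maximal : ∀ {x} → Maximal x → VarComplete x → ∀ φ → x ⊩⁺ φ ⊎ x ⊩⁻ φ
  complete-at-maximal max comp (var i) = comp i
  complete-at-maximal max comp (a ∧ b) with complete-at-maximal max comp a | complete-at-maximal max comp b
  ... | inj₁ ha | inj₁ hb = inj₁ (ha , hb)
  ... | inj₂ ha | _       = inj₂ (inj₁ ha)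
  ... | inj₁ _  | inj₂ hb = inj₂ (inj₂ hb)
  complete-at-maximal max comp (a ∨ b) with complete-at-maximal max comp a | complete-at-maximal max comp b
  ... | inj₁ ha | _       = inj₁ (inj₁ ha)
  ... | inj₂ _  | inj₁ hb = inj₁ (inj₂ hb)
  ... | inj₂ ha | inj₂ hb = inj₂ (ha , hb)
  complete-at-maximal {x} max comp (a ⇒ b) with x ⊩⁺? a
  ... | no ¬ha = inj₁ λ y x≼y ha → ⊥-elim (¬ha (subst (_⊩⁺ a) (max x≼y) ha))
  ... | yes ha with complete-at-maximal max comp b
  ...   | inj₁ hb = inj₁ λ y x≼y _ → ⊩⁺-mono b x≼y hb
  ...   | inj₂ hb = inj₂ (ha , hb)
  complete-at-maximal max comp fls = inj₂ tt
  complete-at-maximal max comp (∼ a) with complete-at-maximal max comp a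
  ... | inj₁ ha = inj₂ ha
  ... | inj₂ ha = inj₁ ha

module SubstitutionLemma {F : FiniteFrame} (v : Valuation F) (σ : ℕ → FormN) where
  open FiniteFrame F
  open Semantics v
  module S = Semantics (induced σ)

  mutual
    sub⁺→ : ∀ φ {x} → x ⊩⁺ subN σ φ → x S.⊩⁺ φ
    sub⁺→ (var i) h         = h
    sub⁺→ (a ∧ b) (ha , hb) = sub⁺→ a ha , sub⁺→ b hb
    sub⁺→ (a ∨ b) (inj₁ h)  = inj₁ (sub⁺→ a h)
    sub⁺→ (a ∨ b) (inj₂ h)  = inj₂ (sub⁺→ b h)
    sub⁺→ (a ⇒ b) h         = λ y x≼y ha → sub⁺→ b (h y x≼y (sub⁺← a ha))
    sub⁺→ (∼ a) h           = sub⁻→ a h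

    sub⁺← : ∀ φ {x} → x S.⊩⁺ φ → x ⊩⁺ subN σ φ
    sub⁺← (var i) h         = h
    sub⁺← (a ∧ b) (ha , hb) = sub⁺← a ha , sub⁺← b hb
    sub⁺← (a ∨ b) (inj₁ h)  = inj₁ (sub⁺← a h)
    sub⁺← (a ∨ b) (inj₂ h)  = inj₂ (sub⁺← b h)
    sub⁺← (a ⇒ b) h         = λ y x≼y ha → sub⁺← b (h y x≼y (sub⁺→ a ha))
    sub⁺← (∼ a) h           = sub⁻← a h

    sub⁻→ : ∀ φ {x} → x ⊩⁻ subN σ φ → x S.⊩⁻ φ
    sub⁻→ (var i) h         = h
    sub⁻→ (a ∧ b) (inj₁ h)  = inj₁ (sub⁻→ a h)
    sub⁻→ (a ∧ b) (inj₂ h)  = inj₂ (sub⁻→ b h)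
    sub⁻→ (a ∨ b) (ha , hb) = sub⁻→ a ha , sub⁻→ b hb
    sub⁻→ (a ⇒ b) (ha , hb) = sub⁺→ a ha , sub⁻→ b hb
    sub⁻→ fls h             = tt
    sub⁻→ (∼ a) h           = sub⁺→ a h

    sub⁻← : ∀ φ {x} → x S.⊩⁻ φ → x ⊩⁻ subN σ φ
    sub⁻← (var i) h         = h
    sub⁻← (a ∧ b) (inj₁ h)  = inj₁ (sub⁻← a h)
    sub⁻← (a ∧ b) (inj₂ h)  = inj₂ (sub⁻← b h)
    sub⁻← (a ∨ b) (ha , hb) = sub⁻← a ha , sub⁻← b hb
    sub⁻← (a ⇒ b) (ha , hb) = sub⁺← a ha , sub⁻← b hb
    sub⁻← fls h             = tt
    sub⁻← (∼ a) h           = sub⁺← a h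

-- The frame condition of χ: gluts occur only at maximal points that decide every variable.
IsNK⊥Valuation : {F : FiniteFrame} → Valuation F → Set
IsNK⊥Valuation {F} v = ∀ {x} → VarGlut x → Maximal x × VarComplete x
  where
  open FiniteFrame F
  open Semantics v

induced-isNK⊥ : ∀ {F} (v : Valuation F) σ → IsNK⊥Valuation v → IsNK⊥Valuation (Semantics.induced v σ)
induced-isNK⊥ v σ nk (i , h⁺ , h⁻) =
  let max , comp = nk (glut⇒var-glut (σ i) h⁺ h⁻) in max , λ j → complete-at-maximal max comp (σ j)
  where open Semantics v

infix 2 _⊨_

_⊨_ : FiniteFrame → FormN → Set₁
F ⊨ φ = ∀ (v : Valuation F) → IsNK⊥Valuation v → ∀ x → Semantics._⊩⁺_ v x φ

⊨-sub : ∀ {F} σ φ → F ⊨ φ → F ⊨ subN σ φ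
⊨-sub σ φ ⊨φ v nk x =
  SubstitutionLemma.sub⁺← v σ φ (⊨φ (Semantics.induced v σ) (induced-isNK⊥ v σ nk) x)

⊨-mp : ∀ {F} φ ψ → F ⊨ φ → F ⊨ φ ⇒ ψ → F ⊨ ψ
⊨-mp {F} _ _ ⊨φ ⊨φ⇒ψ v nk x = ⊨φ⇒ψ v nk x x ≼-refl (⊨φ v nk x)
  where open FiniteFrame F

GenN-sound : ∀ {F X} → (∀ φ → X φ → F ⊨ φ) → ∀ φ → GenN X φ → F ⊨ φ
GenN-sound X⊨ _ (ax σ φ x)   = ⊨-sub σ φ (X⊨ φ x)
GenN-sound X⊨ _ (mp φ ψ d e) = ⊨-mp φ ψ (GenN-sound X⊨ φ d) (GenN-sound X⊨ (φ ⇒ ψ) e)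

GenI-sound : ∀ {F X} → (∀ φ → X φ → F ⊨ embI φ) → ∀ φ → GenI X φ → F ⊨ embI φ
GenI-sound {F} X⊨ _ (ax σ φ x) =
  subst (F ⊨_) (sym (embI-subI σ φ)) (⊨-sub (λ i → embI (σ i)) (embI φ) (X⊨ φ x))
GenI-sound X⊨ _ (mp φ ψ d e) = ⊨-mp (embI φ) (embI ψ) (GenI-sound X⊨ φ d) (GenI-sound X⊨ (φ ⇒ ψ) e)

IntAx-valid : ∀ {F} φ → IntAx φ → F ⊨ embI φ
IntAx-valid {F} _ K   v _ _ = λ y _ hp z y≼z _ → Valuation.V⁺-mono v y≼z hp
  where open FiniteFrame F
IntAx-valid {F} _ S   v _ _ = λ y _ h₁ z y≼z h₂ u z≼u hp → h₁ u (≼-trans y≼z z≼u) hp u ≼-refl (h₂ u z≼u hp)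
  where open FiniteFrame F
IntAx-valid _ ∧e1 v _ _ = λ _ _ → proj₁
IntAx-valid _ ∧e2 v _ _ = λ _ _ → proj₂
IntAx-valid _ ∧i  v _ _ = λ y _ hp z y≼z hq → Valuation.V⁺-mono v y≼z hp , hq
IntAx-valid _ ∨i1 v _ _ = λ _ _ → inj₁
IntAx-valid _ ∨i2 v _ _ = λ _ _ → inj₂
IntAx-valid {F} _ ∨e  v _ _ = λ y _ h₁ z y≼z h₂ u z≼u →
  λ { (inj₁ hp) → h₁ u (≼-trans y≼z z≼u) hp ; (inj₂ hq) → h₂ u z≼u hq }
  where open FiniteFrame F
IntAx-valid _ efq v _ _ = λ _ _ ()

N4Ax-valid : ∀ {F} φ → N4Ax φ → F ⊨ φ
N4Ax-valid _ (int {φ} i) = IntAx-valid φ i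
N4Ax-valid _ ∼∨   v _ _ = (λ _ _ h → h) , (λ _ _ h → h)
N4Ax-valid _ ∼∧   v _ _ = (λ _ _ h → h) , (λ _ _ h → h)
N4Ax-valid _ ∼⇒   v _ _ = (λ _ _ h → h) , (λ _ _ h → h)
N4Ax-valid _ ∼∼   v _ _ = (λ _ _ h → h) , (λ _ _ h → h)
N4Ax-valid _ ∼fls v _ _ = tt

χ-valid : ∀ {F} → F ⊨ χ
χ-valid v nk x y _ (hp , h∼p) = proj₂ (nk (0 , hp , h∼p)) 1

NK⊥+-sound : ∀ {F L} → (∀ φ → L φ → F ⊨ embI φ) → ∀ φ → (NK⊥+ L) φ → F ⊨ φ
NK⊥+-sound L⊨ = GenN-sound λ where
  φ (inj₁ (inj₁ φ∈N4))        → N4Ax-valid φ φ∈N4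
  _ (inj₁ (inj₂ refl))        → χ-valid
  _ (inj₂ (φ , φ∈L , refl))   → L⊨ φ φ∈L

data Two : Set where
  lo hi : Two

data _≤₂_ : Two → Two → Set where
  lo≤   : ∀ {x} → lo ≤₂ x
  hi≤hi : hi ≤₂ hi

≤₂-hi : ∀ x → x ≤₂ hi
≤₂-hi lo = lo≤
≤₂-hi hi = hi≤hi

hi-maximal : ∀ {y} → hi ≤₂ y → y ≡ hi
hi-maximal hi≤hi = refl

Chain₂ : FiniteFrame
Chain₂ = record
  { W = Two ; _≼_ = _≤₂_
  ; _≼?_ = λ { lo _ → yes lo≤ ; hi hi → yes hi≤hi ; hi lo → no λ () }
  ; ≼-refl = λ { {lo} → lo≤ ; {hi} → hi≤hi }
  ; ≼-trans = λ { lo≤ _ → lo≤ ; hi≤hi hi≤hi → hi≤hi }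
  ; points = lo ∷ hi ∷ []
  ; ∈-points = λ { lo → here refl ; hi → there (here refl) } }

htAx-valid : Chain₂ ⊨ embI htAx
htAx-valid v _ = valid
  where
  open Semantics v
  open Valuation v
  p⇒q : ∀ x → ¬ x ⊩⁺ var 0 → V⁺ 1 hi → x ⊩⁺ var 0 ⇒ var 1
  p⇒q _  _   hq hi _ _  = hq
  p⇒q lo ¬hp _  lo _ hp = ⊥-elim (¬hp hp)
  valid : ∀ x → x ⊩⁺ embI htAx
  valid x with x ⊩⁺? var 0 | V⁺? 1 hi
  ... | yes hp | _      = inj₁ hp
  ... | no ¬hp | yes hq = inj₂ (inj₁ (p⇒q x ¬hp hq))
  ... | no _   | no ¬hq = inj₂ (inj₂ λ y _ hq → ¬hq (V⁺-mono (≤₂-hi y) hq))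

HT-valid : ∀ φ → HT φ → Chain₂ ⊨ embI φ
HT-valid = GenI-sound λ where
  φ (inj₁ i)    → IntAx-valid φ i
  _ (inj₂ refl) → htAx-valid

-- ∼p ∧ ¬¬p holds at lo (p is false there and true at hi), but q ∨ ∼q does not.
glutted-p : Valuation Chain₂
glutted-p = record
  { V⁺ = λ _ x → x ≡ hi
  ; V⁻ = λ { ℕ.zero _ → ⊤ ; (ℕ.suc _) _ → ⊥ }
  ; V⁺? = λ { _ lo → no λ () ; _ hi → yes refl }
  ; V⁻? = λ { ℕ.zero _ → yes tt ; (ℕ.suc _) _ → no λ () }
  ; V⁺-mono = λ { hi≤hi refl → refl }
  ; V⁻-mono = λ { {ℕ.zero} _ _ → tt } }

glutted-p-isNK⊥ : IsNK⊥Valuation glutted-p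
glutted-p-isNK⊥ (_ , refl , _) = hi-maximal , λ _ → inj₁ refl

ψ-refuted : ¬ (Chain₂ ⊨ ψ)
ψ-refuted ⊨ψ with ⊨ψ glutted-p glutted-p-isNK⊥ lo lo lo≤ (tt , λ y _ ¬p → ¬p hi (≤₂-hi y) refl)
... | inj₁ ()
... | inj₂ ()

ψ∉NK⊥+ : ∀ L → (∀ φ → L φ → Chain₂ ⊨ embI φ) → ¬ (NK⊥+ L) ψ
ψ∉NK⊥+ L L⊨ ψ∈ = ψ-refuted (NK⊥+-sound L⊨ ψ ψ∈)

record RootedFrame : Set₁ where
  field
    frame : FiniteFrame
  open FiniteFrame frame
  field
    root      : W
    root-≼    : ∀ x → root ≼ x
    ≼-antisym : ∀ {x y} → x ≼ y → y ≼ x → x ≡ y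

module Jankov (R : RootedFrame) where
  open RootedFrame R
  open FiniteFrame frame

  code : W → ℕ
  code w = toℕ (index (∈-points w))

  code-injective : ∀ {w w'} → code w ≡ code w' → w ≡ w'
  code-injective {w} {w'} e =
    trans (lookup-index (∈-points w)) (trans (cong (lookup points) (toℕ-injective e)) (sym (lookup-index (∈-points w'))))

  -- The intended reading of  pv w  is "the current point is not below w".
  pv : W → FormI
  pv w = var (code w)

  ⋀ : List W → (W → FormI) → FormI
  ⋀ []       f = fls ⇒ fls
  ⋀ (w ∷ ws) f = f w ∧ ⋀ ws f

  lower-bound? : ∀ w₁ w₂ z → Dec (z ≼ w₁ × z ≼ w₂)
  lower-bound? w₁ w₂ z = (z ≼? w₁) ×-dec (z ≼? w₂)

  not-above? : ∀ v u → Dec (¬ v ≼ u)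
  not-above? v u = ¬? (v ≼? u)

  filtered : ∀ {P : W → Set} (P? : ∀ w → Dec (P w)) {w} → w ∈ filter P? points → P w
  filtered P? w∈ = proj₂ (∈-filter⁻ P? {xs = points} w∈)

  lower-bounds : W → W → List W
  lower-bounds w₁ w₂ = filter (lower-bound? w₁ w₂) points

  not-above : W → List W
  not-above v = filter (not-above? v) points

  monotone meets covering bounded diagram jankov : FormI
  monotone = ⋀ points λ w → ⋀ (filter (w ≼?_) points) λ v → pv v ⇒ pv w
  covering = ¬I (⋀ points pv)
  meets    = ⋀ points λ w₁ → ⋀ points λ w₂ → ⋀ (lower-bounds w₁ w₂) pv ⇒ (pv w₁ ∨ pv w₂)
  bounded  = ⋀ points λ v → (⋀ (not-above v) pv ⇒ pv v) ⇒ pv v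
  diagram  = monotone ∧ (covering ∧ (meets ∧ bounded))
  jankov   = diagram ⇒ pv root

  module ⋀-Semantics {G : FiniteFrame} (v : Valuation G) where
    open Semantics v

    ⋀-elim : ∀ ws f {x} → x ⊩⁺ embI (⋀ ws f) → ∀ {w} → w ∈ ws → x ⊩⁺ embI (f w)
    ⋀-elim (w ∷ ws) f (h , _) (here refl) = h
    ⋀-elim (w ∷ ws) f (_ , h) (there w∈)  = ⋀-elim ws f h w∈

    ⋀-intro : ∀ ws f {x} → (∀ {w} → w ∈ ws → x ⊩⁺ embI (f w)) → x ⊩⁺ embI (⋀ ws f)
    ⋀-intro []       f h = λ _ _ ()
    ⋀-intro (w ∷ ws) f h = h (here refl) , ⋀-intro ws f (λ w∈ → h (there w∈))

    ⋀-points-elim : ∀ f {x} → x ⊩⁺ embI (⋀ points f) → ∀ w → x ⊩⁺ embI (f w)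
    ⋀-points-elim f h w = ⋀-elim points f h (∈-points w)

  record PMorphism (G : FiniteFrame) (y₀ : FiniteFrame.W G) : Set₁ where
    open FiniteFrame G using () renaming (W to U; _≼_ to _≤_)
    field
      _↦_        : U → W → Set
      total      : ∀ z → y₀ ≤ z → Σ W (z ↦_)
      functional : ∀ {z w w'} → z ↦ w → z ↦ w' → w ≡ w'
      ↦-mono     : ∀ {z z' w w'} → z ≤ z' → z ↦ w → z' ↦ w' → w ≼ w'
      back       : ∀ {z w u} → y₀ ≤ z → z ↦ w → w ≼ u → Σ U λ z' → z ≤ z' × z' ↦ u
      root-↦     : y₀ ↦ root

  -- The least point whose variable is refuted at z is the image of z.
  module Extraction {G : FiniteFrame} (v : Valuation G) {y : FiniteFrame.W G}
                    (diagram-y : Semantics._⊩⁺_ v y (embI diagram))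
                    (¬root : ¬ Valuation.V⁺ v (code root) y) where
    open FiniteFrame G using ()
      renaming (W to U; _≼_ to _≤_; _≼?_ to _≤?_; ≼-refl to ≤-refl; ∃? to ∃U?)
    open Valuation v
    open Semantics v
    open ⋀-Semantics v

    Refutes : U → W → Set
    Refutes z w = ¬ V⁺ (code w) z

    Refutes? : ∀ z w → Dec (Refutes z w)
    Refutes? z w = ¬? (V⁺? (code w) z)

    module _ {z : U} (y≤z : y ≤ z) where
      private
        diagram-z : z ⊩⁺ embI diagram
        diagram-z = ⊩⁺-mono (embI diagram) y≤z diagram-y

      refutes-up : ∀ {w u} → Refutes z w → w ≼ u → Refutes z u
      refutes-up {w} {u} r w≼u Vu = r (mono-wu z ≤-refl Vu)
        where
        mono-wu : z ⊩⁺ embI (pv u ⇒ pv w)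
        mono-wu = ⋀-elim _ _ (⋀-points-elim _ (proj₁ diagram-z) w) (∈-filter⁺ (w ≼?_) (∈-points u) w≼u)

      refutes-some : Σ W (Refutes z)
      refutes-some with ∃? (Refutes? z)
      ... | yes r = r
      ... | no ∄ = ⊥-elim (proj₁ (proj₂ diagram-z) z ≤-refl
                     (⋀-intro points pv λ {w} _ → decidable-stable (V⁺? (code w) z) λ ¬V → ∄ (w , ¬V)))

      refutes-meet : ∀ {w₁ w₂} → Refutes z w₁ → Refutes z w₂ → Σ W λ u → u ≼ w₁ × u ≼ w₂ × Refutes z u
      refutes-meet {w₁} {w₂} r₁ r₂ with ∃? (λ u → (u ≼? w₁) ×-dec ((u ≼? w₂) ×-dec Refutes? z u))
      ... | yes m = m
      ... | no ∄ with ⋀-points-elim _ (⋀-points-elim _ (proj₁ (proj₂ (proj₂ diagram-z))) w₁) w₂ z ≤-refl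
                       (⋀-intro (lower-bounds w₁ w₂) pv λ {u} u∈ → let u≼w₁ , u≼w₂ = filtered (lower-bound? w₁ w₂) u∈ in
                          decidable-stable (V⁺? (code u) z) λ ¬V → ∄ (u , u≼w₁ , u≼w₂ , ¬V))
      ...   | inj₁ V₁ = ⊥-elim (r₁ V₁)
      ...   | inj₂ V₂ = ⊥-elim (r₂ V₂)

      refutes-witness : ∀ {u₀} → Refutes z u₀ →
                        Σ U λ z' → z ≤ z' × Refutes z' u₀ × (∀ u → ¬ u₀ ≼ u → V⁺ (code u) z')
      refutes-witness {u₀} r
        with ∃U? (λ z' → (z ≤? z') ×-dec ((z' ⊩⁺? embI (⋀ (not-above u₀) pv)) ×-dec Refutes? z' u₀))
      ... | yes (z' , z≤z' , above , r') =
            z' , z≤z' , r' , λ u ¬u₀≼u → ⋀-elim _ pv above (∈-filter⁺ (not-above? u₀) (∈-points u) ¬u₀≼u)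
      ... | no ∄ = ⊥-elim (r (⋀-points-elim _ (proj₂ (proj₂ (proj₂ diagram-z))) u₀ z ≤-refl
                     λ z' z≤z' above → decidable-stable (V⁺? (code u₀) z') λ r' → ∄ (z' , z≤z' , above , r')))

      below-all-refuted : ∀ xs c → Refutes z c →
                          Σ W λ c' → Refutes z c' × c' ≼ c × (∀ {u} → u ∈ xs → Refutes z u → c' ≼ u)
      below-all-refuted []       c r = c , r , ≼-refl , λ ()
      below-all-refuted (u ∷ xs) c r with Refutes? z u
      ... | no ¬r =
            let c' , r' , c'≼c , low = below-all-refuted xs c r
            in  c' , r' , c'≼c , λ { (here refl) r → ⊥-elim (¬r r) ; (there u∈) → low u∈ }
      ... | yes ru =
            let m , m≼c , m≼u , rm = refutes-meet r ru
                c' , r' , c'≼m , low = below-all-refuted xs m rm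
            in  c' , r' , ≼-trans c'≼m m≼c , λ { (here refl) _ → ≼-trans c'≼m m≼u ; (there u∈) → low u∈ }

    LeastRefuted : U → W → Set
    LeastRefuted z w = Refutes z w × (∀ u → Refutes z u → w ≼ u)

    least-refuted : ∀ {z} → y ≤ z → Σ W (LeastRefuted z)
    least-refuted y≤z =
      let w , r = refutes-some y≤z
          c , rc , _ , low = below-all-refuted y≤z points w r
      in  c , rc , λ u ru → low (∈-points u) ru

    pmorphism : PMorphism G y
    pmorphism = record
      { _↦_ = LeastRefuted
      ; total = λ _ → least-refuted
      ; functional = λ (r , least) (r' , least') → ≼-antisym (least _ r') (least' _ r)
      ; ↦-mono = λ z≤z' (_ , least) (r' , _) → least _ λ V → r' (V⁺-mono z≤z' V)
      ; back = λ {_} {_} {u} y≤z (r , _) w≼u →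
          let z' , z≤z' , r' , others = refutes-witness y≤z (refutes-up y≤z r w≼u)
          in  z' , z≤z' , r' , λ u' r'' → decidable-stable (u ≼? u') λ ¬u≼u' → r'' (others u' ¬u≼u')
      ; root-↦ = ¬root , λ u _ → root-≼ u }

  jankov-valid : ∀ {G} → (∀ y → ¬ PMorphism G y) → G ⊨ embI jankov
  jankov-valid no-pm v _ x z _ diagram-z with Valuation.V⁺? v (code root) z
  ... | yes r = r
  ... | no ¬r = ⊥-elim (no-pm z (Extraction.pmorphism v diagram-z ¬r))

  not-below : Valuation frame
  not-below = record
    { V⁺ = λ i t → ∀ w → code w ≡ i → ¬ t ≼ w
    ; V⁻ = λ _ _ → ⊥
    ; V⁺? = λ i t → ∀? λ w → (code w ≟ i) →-dec ¬? (t ≼? w)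
    ; V⁻? = λ _ _ → no λ ()
    ; V⁺-mono = λ t≼t' h w e t'≼w → h w e (≼-trans t≼t' t'≼w)
    ; V⁻-mono = λ _ () }

  jankov-refuted : ¬ (frame ⊨ embI jankov)
  jankov-refuted ⊨J = pv⇒not-below (⊨J not-below (λ ()) root root ≼-refl diagram-root) ≼-refl
    where
    open Semantics not-below
    open ⋀-Semantics not-below

    pv⇒not-below : ∀ {w t} → t ⊩⁺ embI (pv w) → ¬ t ≼ w
    pv⇒not-below {w} h = h w refl

    not-below⇒pv : ∀ {w t} → ¬ t ≼ w → t ⊩⁺ embI (pv w)
    not-below⇒pv {w} ¬t≼w w' e with code-injective e
    ... | refl = ¬t≼w

    meets-root : ∀ w₁ w₂ → root ⊩⁺ embI (⋀ (lower-bounds w₁ w₂) pv ⇒ (pv w₁ ∨ pv w₂))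
    meets-root w₁ w₂ t _ lows with t ≼? w₁ | t ≼? w₂
    ... | yes t≼w₁ | yes t≼w₂ =
          ⊥-elim (pv⇒not-below (⋀-elim _ pv lows (∈-filter⁺ (lower-bound? w₁ w₂) (∈-points t) (t≼w₁ , t≼w₂))) ≼-refl)
    ... | no ¬t≼w₁ | _        = inj₁ (not-below⇒pv ¬t≼w₁)
    ... | yes _    | no ¬t≼w₂ = inj₂ (not-below⇒pv ¬t≼w₂)

    diagram-root : root ⊩⁺ embI diagram
    diagram-root =
        ⋀-intro points _ (λ {w} _ → ⋀-intro (filter (w ≼?_) points) (λ v → pv v ⇒ pv w) λ u∈ t _ pv-u →
          not-below⇒pv λ t≼w → pv⇒not-below pv-u (≼-trans t≼w (filtered (w ≼?_) u∈)))
      , (λ t _ all → pv⇒not-below (⋀-points-elim pv all t) ≼-refl)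
      , ⋀-intro points _ (λ {w₁} _ → ⋀-intro points _ λ {w₂} _ → meets-root w₁ w₂)
      , ⋀-intro points _ (λ {v} _ t _ h → not-below⇒pv λ t≼v →
          pv⇒not-below (h v t≼v (⋀-intro (not-above v) pv λ u∈ → not-below⇒pv (filtered (not-above? v) u∈))) ≼-refl)

data Point (n : ℕ) : Set where
  root : Point n
  top  : Fin n → Point n
  mid  : (i j k : Fin n) → .(i ≢ j) → .(j ≢ k) → .(i ≢ k) → Point n

infix 4 _⊑_

_⊑_ : ∀ {n} → Point n → Point n → Set
root            ⊑ _               = ⊤
top i           ⊑ top j           = i ≡ j
top _           ⊑ root            = ⊥
top _           ⊑ mid _ _ _ _ _ _ = ⊥
mid i j k _ _ _ ⊑ mid i' j' k' _ _ _ = i ≡ i' × j ≡ j' × k ≡ k'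
mid i j k _ _ _ ⊑ top t           = t ≡ i ⊎ t ≡ j ⊎ t ≡ k
mid _ _ _ _ _ _ ⊑ root            = ⊥

_⊑?_ : ∀ {n} (x y : Point n) → Dec (x ⊑ y)
root            ⊑? _                  = yes tt
top i           ⊑? top j              = i ≟ᶠ j
top _           ⊑? root               = no λ ()
top _           ⊑? mid _ _ _ _ _ _    = no λ ()
mid i j k _ _ _ ⊑? mid i' j' k' _ _ _ = (i ≟ᶠ i') ×-dec (j ≟ᶠ j') ×-dec (k ≟ᶠ k')
mid i j k _ _ _ ⊑? top t              = (t ≟ᶠ i) ⊎-dec (t ≟ᶠ j) ⊎-dec (t ≟ᶠ k)
mid _ _ _ _ _ _ ⊑? root               = no λ ()

⊑-refl : ∀ {n} {x : Point n} → x ⊑ x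
⊑-refl {x = root}            = tt
⊑-refl {x = top i}           = refl
⊑-refl {x = mid i j k _ _ _} = refl , refl , refl

⊑-trans : ∀ {n} {x y z : Point n} → x ⊑ y → y ⊑ z → x ⊑ z
⊑-trans {x = root} _ _ = tt
⊑-trans {x = top _} {top _} {top _} refl refl = refl
⊑-trans {x = mid _ _ _ _ _ _} {mid _ _ _ _ _ _} {mid _ _ _ _ _ _} (refl , refl , refl) x⊑z = x⊑z
⊑-trans {x = mid _ _ _ _ _ _} {mid _ _ _ _ _ _} {top _} (refl , refl , refl) x⊑z = x⊑z
⊑-trans {x = mid _ _ _ _ _ _} {top _} {top _} x⊑y refl = x⊑y

⊑-antisym : ∀ {n} {x y : Point n} → x ⊑ y → y ⊑ x → x ≡ y
⊑-antisym {x = root} {root} _ _ = refl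
⊑-antisym {x = top _} {top _} refl _ = refl
⊑-antisym {x = mid _ _ _ _ _ _} {mid _ _ _ _ _ _} (refl , refl , refl) _ = refl

mids : ∀ {n} (i j k : Fin n) → List (Point n)
mids i j k with i ≟ᶠ j | j ≟ᶠ k | i ≟ᶠ k
... | no i≢j | no j≢k | no i≢k = mid i j k i≢j j≢k i≢k ∷ []
... | _      | _      | _      = []

∈-mids : ∀ {n} (i j k : Fin n) .(i≢j : i ≢ j) .(j≢k : j ≢ k) .(i≢k : i ≢ k) → mid i j k i≢j j≢k i≢k ∈ mids i j k
∈-mids i j k i≢j j≢k i≢k with i ≟ᶠ j | j ≟ᶠ k | i ≟ᶠ k
... | no _    | no _    | no _    = here refl
... | yes i≡j | _       | _       = Irrelevant.⊥-elim (i≢j i≡j)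
... | no _    | yes j≡k | _       = Irrelevant.⊥-elim (j≢k j≡k)
... | no _    | no _    | yes i≡k = Irrelevant.⊥-elim (i≢k i≡k)

∈-concatMap-allFin : ∀ {n} {B : Set} (f : Fin n → List B) {y} i → y ∈ f i → y ∈ concatMap f (allFin n)
∈-concatMap-allFin f i y∈ = ∈-concatMap⁺ f (lose (∈-allFin i) y∈)

all-points : ∀ n → List (Point n)
all-points n = root ∷ map top (allFin n) ++ concatMap (λ i → concatMap (λ j → concatMap (mids i j) (allFin n)) (allFin n)) (allFin n)

∈-all-points : ∀ {n} (x : Point n) → x ∈ all-points n
∈-all-points root = here refl
∈-all-points (top i) = there (∈-++⁺ˡ (∈-map⁺ top (∈-allFin i)))
∈-all-points {n} (mid i j k i≢j j≢k i≢k) =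
  there (∈-++⁺ʳ (map top (allFin n)) (∈-concatMap-allFin _ i (∈-concatMap-allFin _ j (∈-concatMap-allFin _ k (∈-mids i j k i≢j j≢k i≢k)))))

F : ℕ → FiniteFrame
F n = record
  { W = Point n ; _≼_ = _⊑_ ; _≼?_ = _⊑?_ ; ≼-refl = ⊑-refl ; ≼-trans = ⊑-trans
  ; points = all-points n ; ∈-points = ∈-all-points }

RF : ℕ → RootedFrame
RF n = record { frame = F n ; root = root ; root-≼ = λ _ → tt ; ≼-antisym = ⊑-antisym }

top-injective : ∀ {n} {a b : Fin n} → top {n} a ≡ top b → a ≡ b
top-injective refl = refl

top-maximal : ∀ {n} {i : Fin n} {y} → top i ⊑ y → y ≡ top i
top-maximal {y = top _} refl = refl

top-above : ∀ {n} (x : Point (1 + n)) → Σ (Fin (1 + n)) λ t → x ⊑ top t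
top-above root                = zero , tt
top-above (top t)             = t , refl
top-above (mid i _ _ _ _ _)   = i , inj₁ refl

collision : {A : Set} {x y a b c : A} → a ≡ x ⊎ a ≡ y → b ≡ x ⊎ b ≡ y → c ≡ x ⊎ c ≡ y →
            a ≡ b ⊎ a ≡ c ⊎ b ≡ c
collision (inj₁ a≡x) (inj₁ b≡x) _          = inj₁ (trans a≡x (sym b≡x))
collision (inj₂ a≡y) (inj₂ b≡y) _          = inj₁ (trans a≡y (sym b≡y))
collision (inj₁ a≡x) (inj₂ _)   (inj₁ c≡x) = inj₂ (inj₁ (trans a≡x (sym c≡x)))
collision (inj₂ a≡y) (inj₁ _)   (inj₂ c≡y) = inj₂ (inj₁ (trans a≡y (sym c≡y)))
collision (inj₁ _)   (inj₂ b≡y) (inj₂ c≡y) = inj₂ (inj₂ (trans b≡y (sym c≡y)))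
collision (inj₂ _)   (inj₁ b≡x) (inj₁ c≡x) = inj₂ (inj₂ (trans b≡x (sym c≡x)))

record ThreeTopsAbove {n} (w : Point n) : Set where
  field
    a b c : Fin n
    a≢b   : a ≢ b
    a≢c   : a ≢ c
    b≢c   : b ≢ c
    w⊑a   : w ⊑ top a
    w⊑b   : w ⊑ top b
    w⊑c   : w ⊑ top c

  not-two : ∀ {x y} → (∀ {u} → w ⊑ top u → u ≡ x ⊎ u ≡ y) → ⊥
  not-two two with collision (two w⊑a) (two w⊑b) (two w⊑c)
  ... | inj₁ a≡b        = a≢b a≡b
  ... | inj₂ (inj₁ a≡c) = a≢c a≡c
  ... | inj₂ (inj₂ b≡c) = b≢c b≡c

top-or-three-tops : ∀ {n} (w : Point (3 + n)) → (Σ _ λ s → w ≡ top s) ⊎ ThreeTopsAbove w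
top-or-three-tops root = inj₂ record
  { a = zero ; b = suc zero ; c = suc (suc zero) ; a≢b = λ () ; a≢c = λ () ; b≢c = λ ()
  ; w⊑a = tt ; w⊑b = tt ; w⊑c = tt }
top-or-three-tops (top s) = inj₁ (s , refl)
top-or-three-tops (mid i j k i≢j j≢k i≢k) = inj₂ record
  { a = i ; b = j ; c = k
  ; a≢b = λ e → Irrelevant.⊥-elim (i≢j e) ; a≢c = λ e → Irrelevant.⊥-elim (i≢k e)
  ; b≢c = λ e → Irrelevant.⊥-elim (j≢k e)
  ; w⊑a = inj₁ refl ; w⊑b = inj₂ (inj₁ refl) ; w⊑c = inj₂ (inj₂ refl) }

module _ {n : ℕ} where
  open Jankov (RF (4 + n)) using (PMorphism)

  module PMorphismFromF {m : ℕ} {y₀ : Point (4 + m)} (π : PMorphism (F (4 + m)) y₀) where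
    open PMorphism π

    top-preimage : ∀ {z w u} → y₀ ⊑ z → z ↦ w → w ⊑ top u → Σ _ λ t → z ⊑ top t × top t ↦ top u
    top-preimage y₀⊑z z↦w w⊑u =
      let z' , z⊑z' , z'↦u = back y₀⊑z z↦w w⊑u
          t , z'⊑t = top-above z'
          w' , t↦w' = total (top t) (⊑-trans y₀⊑z (⊑-trans z⊑z' z'⊑t))
      in  t , ⊑-trans z⊑z' z'⊑t , subst (top t ↦_) (top-maximal (↦-mono z'⊑t z'↦u t↦w')) t↦w'

    top-↦-top : ∀ t → y₀ ⊑ top t → Σ _ λ s → top t ↦ top s
    top-↦-top t y₀⊑t =
      let w , t↦w = total (top t) y₀⊑t
          u , w⊑u = top-above w
          t' , t≡t' , t'↦u = top-preimage y₀⊑t t↦w w⊑u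
      in  u , subst (λ t' → top t' ↦ top u) (sym t≡t') t'↦u

  no-pmorphism-at-top : ∀ {m i} → ¬ PMorphism (F (4 + m)) (top i)
  no-pmorphism-at-top π =
    let t , i≡t , t↦0 = top-preimage {u = zero} ⊑-refl root-↦ tt
    in  root≢top (functional root-↦ (subst (λ t → top t ↦ top zero) (sym i≡t) t↦0))
    where
    open PMorphism π
    open PMorphismFromF π
    root≢top : root ≢ top zero
    root≢top ()

  no-pmorphism-at-mid : ∀ {m i j k} .{i≢j : i ≢ j} .{j≢k : j ≢ k} .{i≢k : i ≢ k} →
                        ¬ PMorphism (F (4 + m)) (mid i j k i≢j j≢k i≢k)
  no-pmorphism-at-mid {m} {i} {j} {k} {i≢j} {j≢k} {i≢k} π = 4≰3 (injective⇒≤ slot-injective)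
    where
    open PMorphism π
    open PMorphismFromF π
    y₀ : Point (4 + m)
    y₀ = mid i j k i≢j j≢k i≢k

    triple : Fin 3 → Fin (4 + m)
    triple zero             = i
    triple (suc zero)       = j
    triple (suc (suc zero)) = k

    preimage : (s : Fin 4) → Σ (Fin 3) λ c → top (triple c) ↦ top (s ↑ˡ n)
    preimage s with top-preimage {u = s ↑ˡ n} (⊑-refl {x = y₀}) root-↦ tt
    ... | _ , inj₁ refl , t↦s        = zero , t↦s
    ... | _ , inj₂ (inj₁ refl) , t↦s = suc zero , t↦s
    ... | _ , inj₂ (inj₂ refl) , t↦s = suc (suc zero) , t↦s

    slot-injective : ∀ {a b} → proj₁ (preimage a) ≡ proj₁ (preimage b) → a ≡ b
    slot-injective {a} {b} e = ↑ˡ-injective n a b (top-injective (functional (proj₂ (preimage a)) ↦b))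
      where
      ↦b : top (triple (proj₁ (preimage a))) ↦ top (b ↑ˡ n)
      ↦b = subst (λ c → top (triple c) ↦ top (b ↑ˡ n)) (sym e) (proj₂ (preimage b))

    4≰3 : ¬ 4 ℕ.≤ 3
    4≰3 (ℕ.s≤s (ℕ.s≤s (ℕ.s≤s ())))

  module AtRoot {m : ℕ} (π : PMorphism (F (4 + m)) root) where
    open PMorphism π
    open PMorphismFromF π

    g : Fin (4 + m) → Fin (4 + n)
    g t = proj₁ (top-↦-top t tt)

    g-↦ : ∀ t → top t ↦ top (g t)
    g-↦ t = proj₂ (top-↦-top t tt)

    ↦⇒≡g : ∀ {t u} → top t ↦ top u → u ≡ g t
    ↦⇒≡g {t} t↦u = top-injective (functional t↦u (g-↦ t))

    section : Fin (4 + n) → Fin (4 + m)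
    section u = proj₁ (top-preimage {u = u} tt root-↦ tt)

    g∘section : ∀ u → g (section u) ≡ u
    g∘section u = sym (↦⇒≡g (proj₂ (proj₂ (top-preimage {u = u} tt root-↦ tt))))

    section-injective : ∀ {u u'} → section u ≡ section u' → u ≡ u'
    section-injective {u} {u'} e = trans (sym (g∘section u)) (trans (cong g e) (g∘section u'))

    -- Every top above the image of mid i j k is the image of i, j or k.
    collapse : ∀ {i j k} → i ≢ j → j ≢ k → i ≢ k → g i ≡ g j → g k ≡ g i
    collapse {i} {j} {k} i≢j j≢k i≢k gi≡gj with total (mid i j k i≢j j≢k i≢k) tt
    ... | w , z↦w with top-or-three-tops w
    ...   | inj₁ (s , refl) = trans (sym (↦-mono (inj₂ (inj₂ refl)) z↦w (g-↦ k)))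
                                    (↦-mono (inj₁ refl) z↦w (g-↦ i))
    ...   | inj₂ three = ⊥-elim (ThreeTopsAbove.not-two three tops-above-w)
      where
      tops-above-w : ∀ {u} → w ⊑ top u → u ≡ g i ⊎ u ≡ g k
      tops-above-w w⊑u with top-preimage tt z↦w w⊑u
      ... | t , inj₁ refl , t↦u        = inj₁ (↦⇒≡g t↦u)
      ... | t , inj₂ (inj₁ refl) , t↦u = inj₁ (trans (↦⇒≡g t↦u) (sym gi≡gj))
      ... | t , inj₂ (inj₂ refl) , t↦u = inj₂ (↦⇒≡g t↦u)

    constant : ∀ {i j} → i ≢ j → g i ≡ g j → ∀ t → g t ≡ g i
    constant {i} {j} i≢j gi≡gj t with t ≟ᶠ i | t ≟ᶠ j
    ... | yes refl | _        = refl
    ... | no _     | yes refl = sym gi≡gj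
    ... | no t≢i   | no t≢j   = collapse i≢j (λ j≡t → t≢j (sym j≡t)) (λ i≡t → t≢i (sym i≡t)) gi≡gj

    g-injective : ∀ {i j} → g i ≡ g j → i ≡ j
    g-injective {i} {j} gi≡gj with i ≟ᶠ j
    ... | yes i≡j = i≡j
    ... | no i≢j  = ⊥-elim (other≢ (trans (sym (g∘section other)) (constant i≢j gi≡gj (section other))))
      where
      other : Fin (4 + n)
      other with g i
      ... | zero  = suc zero
      ... | suc _ = zero
      other≢ : other ≢ g i
      other≢ with g i
      ... | zero  = λ ()
      ... | suc _ = λ ()

    m≡n : m ≡ n
    m≡n = +-cancelˡ-≡ 4 m n (≤-antisym (injective⇒≤ g-injective) (injective⇒≤ section-injective))

  pmorphism⇒≡ : ∀ {m} y₀ → PMorphism (F (4 + m)) y₀ → m ≡ n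
  pmorphism⇒≡ root              π = AtRoot.m≡n π
  pmorphism⇒≡ (top _)           π = ⊥-elim (no-pmorphism-at-top π)
  pmorphism⇒≡ (mid _ _ _ _ _ _) π = ⊥-elim (no-pmorphism-at-mid π)

  no-pmorphism-Chain₂ : ∀ y₀ → ¬ PMorphism Chain₂ y₀
  no-pmorphism-Chain₂ y₀ π = 4+n≰2 (injective⇒≤ {f = λ u → position (proj₁ (preimage u))} preimage-injective)
    where
    open PMorphism π
    preimage : ∀ u → Σ Two (_↦ top u)
    preimage u = let z , _ , z↦u = back (FiniteFrame.≼-refl Chain₂) root-↦ tt in z , z↦u
    position : Two → Fin 2
    position lo = zero
    position hi = suc zero
    position-injective : ∀ {a b} → position a ≡ position b → a ≡ b
    position-injective {lo} {lo} _ = refl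
    position-injective {hi} {hi} _ = refl
    preimage-injective : ∀ {u u'} → position (proj₁ (preimage u)) ≡ position (proj₁ (preimage u')) → u ≡ u'
    preimage-injective {u} {u'} e = top-injective
      (functional (proj₂ (preimage u)) (subst (_↦ top u') (sym (position-injective e)) (proj₂ (preimage u'))))
    4+n≰2 : ¬ 4 + n ℕ.≤ 2
    4+n≰2 (ℕ.s≤s (ℕ.s≤s ()))

jankov : ℕ → FormI
jankov n = Jankov.jankov (RF (4 + n))

Jankovs : (ℕ → Bool) → Pred FormI
Jankovs f φ = Σ ℕ λ n → f n ≡ true × jankov n ≡ φ

NK⊥+-isExtension : ∀ L → ExtensionOfN4⊥ (NK⊥+ L)
NK⊥+-isExtension L = GenN-isLogic _ , GenN-mono λ _ φ∈N4 → inj₁ (inj₁ φ∈N4)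

χ∈NK⊥+ : ∀ L → (NK⊥+ L) χ
χ∈NK⊥+ L = GenN-ax χ (inj₁ (inj₂ refl))

NK⊥+-noModalCompanion : ∀ L → (∀ φ → L φ → Chain₂ ⊨ embI φ) → HasNoModalCompanion (NK⊥+ L)
NK⊥+-noModalCompanion L L⊨ = noModalCompanion (NK⊥+ L) (χ∈NK⊥+ L) (ψ∉NK⊥+ L L⊨)

Jankovs-valid-Chain₂ : ∀ f φ → Jankovs f φ → Chain₂ ⊨ embI φ
Jankovs-valid-Chain₂ f _ (n , _ , refl) = Jankov.jankov-valid (RF (4 + n)) no-pmorphism-Chain₂

jankov∈ : ∀ f n → f n ≡ true → (NK⊥+ Jankovs f) (embI (jankov n))
jankov∈ f n fn = GenN-ax _ (inj₂ (jankov n , (n , fn , refl) , refl))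

jankov∉ : ∀ g n → g n ≡ false → ¬ (NK⊥+ Jankovs g) (embI (jankov n))
jankov∉ g n gn J∈ = Jankov.jankov-refuted (RF (4 + n)) (NK⊥+-sound Jankovs-valid _ J∈)
  where
  true≢false : true ≢ false
  true≢false ()
  Jankovs-valid : ∀ φ → Jankovs g φ → F (4 + n) ⊨ embI φ
  Jankovs-valid _ (k , gk , refl) = Jankov.jankov-valid (RF (4 + k)) λ y π →
    true≢false (trans (sym gk) (trans (cong g (sym (pmorphism⇒≡ {k} y π))) gn))

NK⊥+Jankovs-injective : ∀ f g →
  (∀ φ → ((NK⊥+ Jankovs f) φ → (NK⊥+ Jankovs g) φ) × ((NK⊥+ Jankovs g) φ → (NK⊥+ Jankovs f) φ)) →
  ∀ n → f n ≡ g n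
NK⊥+Jankovs-injective f g same n = compare (f n) (g n) refl refl
  where
  J = embI (jankov n)
  compare : ∀ a b → f n ≡ a → g n ≡ b → f n ≡ g n
  compare true  true  fn gn = trans fn (sym gn)
  compare false false fn gn = trans fn (sym gn)
  compare true  false fn gn = ⊥-elim (jankov∉ g n gn (proj₁ (same J) (jankov∈ f n fn)))
  compare false true  fn gn = ⊥-elim (jankov∉ f n fn (proj₂ (same J) (jankov∈ g n gn)))

mainTheorem20 : HasNoModalCompanion NK⊥
    × ((L : Pred FormI) → SuperIntuitionistic L → L ⊆ HT → HasNoModalCompanion (NK⊥+ L))
    × Σ ((ℕ → Bool) → Pred FormN) (λ E →
        ((f : ℕ → Bool) → ExtensionOfN4⊥ (E f) × HasNoModalCompanion (E f))
        × ((f g : ℕ → Bool) → ((φ : FormN) → (E f φ → E g φ) × (E g φ → E f φ)) → (n : ℕ) → f n ≡ g n))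
mainTheorem20 =
    noModalCompanion NK⊥ (GenN-ax χ (inj₂ refl)) (λ ψ∈NK⊥ → ψ∉NK⊥+ HT HT-valid (GenN-mono (λ _ → inj₁) ψ ψ∈NK⊥))
  , (λ L _ L⊆HT → NK⊥+-noModalCompanion L λ φ φ∈L → HT-valid φ (L⊆HT φ φ∈L))
  , (λ f → NK⊥+ Jankovs f)
  , (λ f → NK⊥+-isExtension (Jankovs f) , NK⊥+-noModalCompanion (Jankovs f) (Jankovs-valid-Chain₂ f))
  , NK⊥+Jankovs-injective
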